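{- For all $X,Y\subseteq\omega$, if $X\leq_T Y$ then $\mathcal{K}_1^X$ embeds into $\mathcal{K}_1^Y$ via a computable embedding. Likewise, $\mathcal{K}_1$ embeds into $\mathcal{K}_1^X$ via a computable embedding for every $X\subseteq\omega$.
   Context: For $X\subseteq\omega$, $\mathcal{K}_1^X$ is the pca on $\omega$ with $n\cdot m=\Phi_n^X(m)$ ($\Phi_n^X$ the $n$-th partial $X$-computable function, oracle machines being encoded differently from plain machines); $\mathcal{K}_1$ is the pca on $\omega$ with $n\cdot m=\Phi_n(m)$. For pca's $\mathcal{A},\mathcal{B}$, an embedding is an injective map $F:\mathcal{A}\to\mathcal{B}$ such that for all $a,b,c$: if $a\cdot_\mathcal{A}b$ is defined and equals $c$ then $F(a)\cdot_\mathcal{B}F(b)$ is defined and equals $F(c)$; if $a\cdot_\mathcal{A}b$ is undefined then so is $F(a)\cdot_\mathcal{B}F(b)$. -}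

module Defs where

open import Data.Nat using (ℕ; zero; suc; _+_; _<_)
open import Data.Bool using (Bool; true; false)
open import Data.Maybe using (Maybe; just; nothing)
open import Data.Product using (Σ; _×_; _,_; ∃)
open import Relation.Nullary using (¬_)
open import Relation.Binary.PropositionalEquality using (_≡_)
open import Function.Definitions using (Injective)

Subset : Set
Subset = ℕ → Bool

χ : Subset → ℕ → ℕ
χ X n with X n
... | true  = 1
... | false = 0

tri : ℕ → ℕ
tri zero    = zero
tri (suc k) = suc k + tri k

pair : ℕ → ℕ → ℕ
pair a b = tri (a + b) + b

-- An index e denotes:
--   pair 0 0           : x ↦ 0
--   pair 1 0           : x ↦ x + 1
--   pair 2 0           : x ↦ x
--   pair 3 0           : pair a b ↦ a
--   pair 4 0           : pair a b ↦ b
--   pair 5 (pair f g)  : x ↦ pair (Φ_f x) (Φ_g x)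
--   pair 6 (pair f g)  : x ↦ Φ_f (Φ_g x)
--   pair 7 (pair f g)  : primitive recursion
--                        pair a 0       ↦ Φ_f a
--                        pair a (n+1)   ↦ Φ_g (pair (pair a n) (Φ_e (pair a n)))
--   pair 8 f           : x ↦ μn. Φ_f (pair x n) = 0
--   pair 9 0           : x ↦ χ_X(x)      (oracle query; only for oracle machines)
-- Every other index denotes the nowhere-defined function.
-- The oracle argument is 'nothing' for plain machines and 'just X' for
-- X-oracle machines, so oracle machines and plain machines are encoded by
-- different numberings (index pair 9 0 is nowhere defined for plain machines).
-- Eval O e x y  means  Φ_e^O(x) ↓ = y.
data Eval : Maybe Subset → ℕ → ℕ → ℕ → Set where
  ev-zero : ∀ {O x} → Eval O (pair 0 0) x 0
  ev-succ : ∀ {O x} → Eval O (pair 1 0) x (suc x)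
  ev-id   : ∀ {O x} → Eval O (pair 2 0) x x
  ev-fst  : ∀ {O a b} → Eval O (pair 3 0) (pair a b) a
  ev-snd  : ∀ {O a b} → Eval O (pair 4 0) (pair a b) b
  ev-pair : ∀ {O f g x y z} → Eval O f x y → Eval O g x z →
            Eval O (pair 5 (pair f g)) x (pair y z)
  ev-comp : ∀ {O f g x y z} → Eval O g x y → Eval O f y z →
            Eval O (pair 6 (pair f g)) x z
  ev-rec0 : ∀ {O f g a y} → Eval O f a y →
            Eval O (pair 7 (pair f g)) (pair a 0) y
  ev-recS : ∀ {O f g a n y z} → Eval O (pair 7 (pair f g)) (pair a n) y →
            Eval O g (pair (pair a n) y) z →
            Eval O (pair 7 (pair f g)) (pair a (suc n)) z
  ev-mu   : ∀ {O f x n} → Eval O f (pair x n) 0 →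
            (∀ m → m < n → Σ ℕ (λ k → Eval O f (pair x m) (suc k))) →
            Eval O (pair 8 f) x n
  ev-orac : ∀ {X x} → Eval (just X) (pair 9 0) x (χ X x)

-- Application in K₁^O :  n · m = Φ_n^O(m)  (as a graph relation).
-- K₁ is K₁^nothing (plain machines), K₁^X is K₁^(just X).

_≤T_ : Subset → Subset → Set
X ≤T Y = Σ ℕ λ e → ∀ n → Eval (just Y) e n (χ X n)

Computable : (ℕ → ℕ) → Set
Computable F = Σ ℕ λ e → ∀ n → Eval nothing e n (F n)

IsEmbedding : Maybe Subset → Maybe Subset → (ℕ → ℕ) → Set
IsEmbedding O P F =
  Injective _≡_ _≡_ F ×
  (∀ a b c → Eval O a b c → Eval P (F a) (F b) (F c)) ×
  (∀ a b → ¬ (∃ λ c → Eval O a b c) → ¬ (∃ λ c → Eval P (F a) (F b) c))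

ComputablyEmbeds : Maybe Subset → Maybe Subset → Set
ComputablyEmbeds O P = Σ (ℕ → ℕ) λ F → Computable F × IsEmbedding O P F

-- An X-oracle machine a becomes a Y-oracle machine translate a by replacing
-- every oracle query in a with a code c computing χ_X relative to Y (for plain
-- machines, with a nowhere defined code).  The translation is primitive
-- recursive on codes, and translate a evaluates relative to Y exactly as a
-- does relative to X.  It need not be injective, so the embedding is
--   embed a = E ∘ translate a ∘ tag a,
-- where tag a reads b off embed b and keeps a recoverable from the code, and E
-- computes embed itself, by Kleene's recursion theorem.  Then
-- embed a · embed b = E (translate a · b) = embed (a · b), and every
-- computation of embed a · embed b runs through translate a · b, so
-- undefinedness is preserved as well.

module Submission where

open import Defs
open import Data.Maybe using (Maybe; just; nothing)
open import Data.Product using (_×_; Σ; ∃; _,_; proj₁; proj₂)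
open import Data.Nat using (ℕ; zero; suc; _+_; _∸_; _≤_; _<_; z≤n; s≤s; pred)
open import Data.Nat.Properties
open import Data.Nat.GeneralisedArithmetic using (fold; iterate; iterate-is-fold)
open import Data.Empty using (⊥-elim)
open import Relation.Nullary using (¬_)
open import Relation.Binary.PropositionalEquality
open import Relation.Binary.Definitions using (tri<; tri≈; tri>)

next : ℕ × ℕ → ℕ × ℕ
next (zero  , b) = suc b , 0
next (suc a , b) = a , suc b

unpair : ℕ → ℕ × ℕ
unpair zero    = 0 , 0
unpair (suc n) = next (unpair n)

π₁ π₂ : ℕ → ℕ
π₁ n = proj₁ (unpair n)
π₂ n = proj₂ (unpair n)

pair-suc-snd : ∀ a b → pair a (suc b) ≡ suc (pair (suc a) b)
pair-suc-snd a b = begin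
  tri (a + suc b) + suc b   ≡⟨ cong (λ s → tri s + suc b) (+-suc a b) ⟩
  tri (suc (a + b)) + suc b ≡⟨ +-suc _ b ⟩
  suc (tri (suc a + b) + b) ∎
  where open ≡-Reasoning

pair-suc-fst : ∀ a → pair (suc a) 0 ≡ suc (pair 0 a)
pair-suc-fst a = begin
  tri (suc a + 0) + 0 ≡⟨ +-identityʳ _ ⟩
  tri (suc (a + 0))   ≡⟨ cong (λ s → tri (suc s)) (+-identityʳ a) ⟩
  suc (a + tri a)     ≡⟨ cong suc (+-comm a (tri a)) ⟩
  suc (tri a + a)     ∎
  where open ≡-Reasoning

unpair-pair : ∀ a b → unpair (pair a b) ≡ (a , b)
unpair-pair a b = on-diagonal (a + b) a b refl
  where
  on-diagonal : ∀ s a b → a + b ≡ s → unpair (pair a b) ≡ (a , b)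
  on-diagonal s a (suc b) a+b≡s = trans (cong unpair (pair-suc-snd a b))
    (cong next (on-diagonal s (suc a) b (trans (sym (+-suc a b)) a+b≡s)))
  on-diagonal (suc s) (suc a) zero a+0≡s = trans (cong unpair (pair-suc-fst a))
    (cong next (on-diagonal s 0 a (suc-injective (trans (sym (+-identityʳ (suc a))) a+0≡s))))
  on-diagonal zero    zero    zero _  = refl
  on-diagonal zero    (suc a) zero ()
  on-diagonal (suc s) zero    zero ()

π₁-pair : ∀ a b → π₁ (pair a b) ≡ a
π₁-pair a b = cong proj₁ (unpair-pair a b)

π₂-pair : ∀ a b → π₂ (pair a b) ≡ b
π₂-pair a b = cong proj₂ (unpair-pair a b)

pair-unpair : ∀ n → pair (π₁ n) (π₂ n) ≡ n
pair-unpair zero    = refl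
pair-unpair (suc n) = trans (pair-next (unpair n)) (cong suc (pair-unpair n))
  where
  pair-next : ∀ p → pair (proj₁ (next p)) (proj₂ (next p)) ≡ suc (pair (proj₁ p) (proj₂ p))
  pair-next (zero  , b) = pair-suc-fst b
  pair-next (suc a , b) = pair-suc-snd a b

-- Agda cannot solve pair ?a ?b = pair a b, so the components are explicit.
pair-injective : ∀ a b a′ b′ → pair a b ≡ pair a′ b′ → a ≡ a′ × b ≡ b′
pair-injective a b a′ b′ eq =
  trans (sym (π₁-pair a b)) (trans (cong π₁ eq) (π₁-pair a′ b′)) ,
  trans (sym (π₂-pair a b)) (trans (cong π₂ eq) (π₂-pair a′ b′))

operands-injective : ∀ k f g k′ f′ g′ →
                     pair k (pair f g) ≡ pair k′ (pair f′ g′) → f ≡ f′ × g ≡ g′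
operands-injective k f g k′ f′ g′ eq =
  pair-injective f g f′ g′ (proj₂ (pair-injective k (pair f g) k′ (pair f′ g′) eq))

n≤tri[n] : ∀ n → n ≤ tri n
n≤tri[n] zero    = z≤n
n≤tri[n] (suc n) = m≤m+n (suc n) (tri n)

≤-pairˡ : ∀ a b → a ≤ pair a b
≤-pairˡ a b = ≤-trans (m≤m+n a b) (≤-trans (n≤tri[n] (a + b)) (m≤m+n _ b))

≤-pairʳ : ∀ a b → b ≤ pair a b
≤-pairʳ a b = m≤n+m b _

<-pairʳ : ∀ k b → b < pair (suc k) b
<-pairʳ k b = ≤-trans (s≤s (m≤n+m b k)) (≤-trans (n≤tri[n] (suc k + b)) (m≤m+n _ b))

-- Shape k d: the last instruction of d has opcode k.  As k is a literal,
-- matching on a Shape rules out the other instructions, which unifying codes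
-- of the form pair k m cannot.
data Shape : ∀ {O e x y} → ℕ → Eval O e x y → Set where
  zero-shape : ∀ {O x} → Shape 0 (ev-zero {O} {x})
  succ-shape : ∀ {O x} → Shape 1 (ev-succ {O} {x})
  id-shape   : ∀ {O x} → Shape 2 (ev-id {O} {x})
  fst-shape  : ∀ {O a b} → Shape 3 (ev-fst {O} {a} {b})
  snd-shape  : ∀ {O a b} → Shape 4 (ev-snd {O} {a} {b})
  pair-shape : ∀ {O f g x y z} {p : Eval O f x y} {q : Eval O g x z} →
               Shape 5 (ev-pair p q)
  comp-shape : ∀ {O f g x y z} {p : Eval O g x y} {q : Eval O f y z} →
               Shape 6 (ev-comp p q)
  rec0-shape : ∀ {O f g a y} {p : Eval O f a y} → Shape 7 (ev-rec0 {g = g} p)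
  recS-shape : ∀ {O f g a n y z} {p : Eval O (pair 7 (pair f g)) (pair a n) y}
                 {q : Eval O g (pair (pair a n) y) z} →
               Shape 7 (ev-recS {f = f} {g} {a} {n} p q)
  mu-shape   : ∀ {O f x n} {p : Eval O f (pair x n) 0}
                 {h : ∀ m → m < n → Σ ℕ (λ k → Eval O f (pair x m) (suc k))} →
               Shape 8 (ev-mu {f = f} {x} {n} p h)
  orac-shape : ∀ {X x} → Shape 9 (ev-orac {X} {x})

shape-of : ∀ {O e x y} k m (d : Eval O e x y) → e ≡ pair k m → Shape k d
shape-of k m d refl = shape d (π₁-pair k m)
  where
  relabel : ∀ {O x y j} k m {d : Eval O (pair k m) x y} →
            Shape k d → π₁ (pair k m) ≡ j → Shape j d
  relabel k m s eq = subst (λ j → Shape j _) (trans (sym (π₁-pair k m)) eq) s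

  shape : ∀ {O e x y k} (d : Eval O e x y) → π₁ e ≡ k → Shape k d
  shape ev-zero refl = zero-shape
  shape ev-succ refl = succ-shape
  shape ev-id   refl = id-shape
  shape ev-fst  refl = fst-shape
  shape ev-snd  refl = snd-shape
  shape (ev-pair {f = f} {g} _ _) = relabel 5 (pair f g) pair-shape
  shape (ev-comp {f = f} {g} _ _) = relabel 6 (pair f g) comp-shape
  shape (ev-rec0 {f = f} {g} _)   = relabel 7 (pair f g) rec0-shape
  shape (ev-recS {f = f} {g} _ _) = relabel 7 (pair f g) recS-shape
  shape (ev-mu {f = f} _ _)       = relabel 8 f mu-shape
  shape ev-orac refl = orac-shape

recode : ∀ {O e e′ x y} → e ≡ e′ → Eval O e x y → Eval O e′ x y
recode eq d = subst (λ e → Eval _ e _ _) eq d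

eval-deterministic : ∀ {O e e′ x x′ y y′} →
                     Eval O e x y → Eval O e′ x′ y′ → e ≡ e′ → x ≡ x′ → y ≡ y′
eval-deterministic ev-zero d′ ee _ with shape-of 0 0 d′ (sym ee)
... | zero-shape = refl
eval-deterministic ev-succ d′ ee ex with shape-of 1 0 d′ (sym ee)
... | succ-shape = cong suc ex
eval-deterministic ev-id d′ ee ex with shape-of 2 0 d′ (sym ee)
... | id-shape = ex
eval-deterministic (ev-fst {a = a} {b}) d′ ee ex with shape-of 3 0 d′ (sym ee)
... | fst-shape {a = a′} {b′} = proj₁ (pair-injective a b a′ b′ ex)
eval-deterministic (ev-snd {a = a} {b}) d′ ee ex with shape-of 4 0 d′ (sym ee)
... | snd-shape {a = a′} {b′} = proj₂ (pair-injective a b a′ b′ ex)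
eval-deterministic (ev-pair {f = f} {g} p q) d′ ee ex with shape-of 5 (pair f g) d′ (sym ee)
... | pair-shape {f = f′} {g′} {p = p′} {q′} with operands-injective 5 f g 5 f′ g′ ee
... | refl , refl =
  cong₂ pair (eval-deterministic p p′ refl ex) (eval-deterministic q q′ refl ex)
eval-deterministic (ev-comp {f = f} {g} p q) d′ ee ex with shape-of 6 (pair f g) d′ (sym ee)
... | comp-shape {f = f′} {g′} {p = p′} {q′} with operands-injective 6 f g 6 f′ g′ ee
... | refl , refl = eval-deterministic q q′ refl (eval-deterministic p p′ refl ex)
eval-deterministic (ev-rec0 {f = f} {g} {a} p) d′ ee ex with shape-of 7 (pair f g) d′ (sym ee)
... | recS-shape {a = a′} {n′} = ⊥-elim (0≢1+n (proj₂ (pair-injective a 0 a′ (suc n′) ex)))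
... | rec0-shape {f = f′} {g′} {a′} {p = p′} with operands-injective 7 f g 7 f′ g′ ee
... | refl , refl = eval-deterministic p p′ refl (proj₁ (pair-injective a 0 a′ 0 ex))
eval-deterministic (ev-recS {f = f} {g} {a} {n} p q) d′ ee ex
  with shape-of 7 (pair f g) d′ (sym ee)
... | rec0-shape {a = a′} = ⊥-elim (1+n≢0 (proj₂ (pair-injective a (suc n) a′ 0 ex)))
... | recS-shape {f = f′} {g′} {a′} {n′} {p = p′} {q′}
  with operands-injective 7 f g 7 f′ g′ ee | pair-injective a (suc n) a′ (suc n′) ex
... | refl , refl | refl , refl with eval-deterministic p p′ refl refl
... | refl = eval-deterministic q q′ refl refl
eval-deterministic (ev-mu {f = f} {n = n} p h) d′ ee ex with shape-of 8 f d′ (sym ee)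
... | mu-shape {f = f′} {n = n′} {p = p′} {h′}
  with proj₂ (pair-injective 8 f 8 f′ ee) | ex | <-cmp n n′
... | refl | refl | tri< n<n′ _ _ =
  ⊥-elim (0≢1+n (eval-deterministic p (proj₂ (h′ n n<n′)) refl refl))
... | refl | refl | tri≈ _ n≡n′ _ = n≡n′
... | refl | refl | tri> _ _ n′<n =
  ⊥-elim (1+n≢0 (eval-deterministic (proj₂ (h n′ n′<n)) p′ refl refl))
eval-deterministic ev-orac d′ ee ex with shape-of 9 0 d′ (sym ee)
... | orac-shape = cong (χ _) ex

-- The codes whose meaning can depend on the oracle.
data Active : ℕ → ℕ → Set where
  active-pair   : ∀ {m} → Active 5 m
  active-comp   : ∀ {m} → Active 6 m
  active-rec    : ∀ {m} → Active 7 m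
  active-mu     : ∀ {m} → Active 8 m
  active-oracle : Active 9 0

Inert : ℕ → Set
Inert a = ∀ {k m} → a ≡ pair k m → ¬ Active k m

inert-eval : ∀ {O P a x y} → Inert a → Eval O a x y → Eval P a x y
inert-eval _ ev-zero = ev-zero
inert-eval _ ev-succ = ev-succ
inert-eval _ ev-id   = ev-id
inert-eval _ (ev-fst {a = a} {b}) = ev-fst {a = a} {b}
inert-eval _ (ev-snd {a = a} {b}) = ev-snd {a = a} {b}
inert-eval inert (ev-pair {f = f} {g} _ _) = ⊥-elim (inert {5} {pair f g} refl active-pair)
inert-eval inert (ev-comp {f = f} {g} _ _) = ⊥-elim (inert {6} {pair f g} refl active-comp)
inert-eval inert (ev-rec0 {f = f} {g} _)   = ⊥-elim (inert {7} {pair f g} refl active-rec)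
inert-eval inert (ev-recS {f = f} {g} _ _) = ⊥-elim (inert {7} {pair f g} refl active-rec)
inert-eval inert (ev-mu {f = f} _ _)       = ⊥-elim (inert {8} {f} refl active-mu)
inert-eval inert ev-orac                   = ⊥-elim (inert {9} {0} refl active-oracle)

zeroᶜ sucᶜ idᶜ fstᶜ sndᶜ oracleᶜ ⊥ᶜ : ℕ
zeroᶜ   = pair 0 0
sucᶜ    = pair 1 0
idᶜ     = pair 2 0
fstᶜ    = pair 3 0
sndᶜ    = pair 4 0
oracleᶜ = pair 9 0
⊥ᶜ      = pair 10 0

oracleᶜ-undefined-in-plain : ∀ {x y} → ¬ Eval nothing oracleᶜ x y
oracleᶜ-undefined-in-plain d with shape-of 9 0 d refl
... | ()

⊥ᶜ-undefined : ∀ {O x y} → ¬ Eval O ⊥ᶜ x y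
⊥ᶜ-undefined d with shape-of 10 0 d refl
... | ()

infixr 9 _∘ᶜ_
infixl 5 _⨾_

-- Opaque, so that codes built from these stay neutral terms: Agda neither
-- unfolds them into huge numerals nor fails to solve f ∘ᶜ ?g = f ∘ᶜ g.
opaque
  _∘ᶜ_ ⟨_,_⟩ᶜ recᶜ : ℕ → ℕ → ℕ
  f ∘ᶜ g     = pair 6 (pair f g)
  ⟨ f , g ⟩ᶜ = pair 5 (pair f g)
  recᶜ f g   = pair 7 (pair f g)

  ∘ᶜ-unfold : ∀ {f g} → f ∘ᶜ g ≡ pair 6 (pair f g)
  ∘ᶜ-unfold = refl

  ⟨,⟩ᶜ-unfold : ∀ {f g} → ⟨ f , g ⟩ᶜ ≡ pair 5 (pair f g)
  ⟨,⟩ᶜ-unfold = refl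

  recᶜ-unfold : ∀ {f g} → recᶜ f g ≡ pair 7 (pair f g)
  recᶜ-unfold = refl

  _⨾_ : ∀ {O f g x y z} → Eval O g x y → Eval O f y z → Eval O (f ∘ᶜ g) x z
  p ⨾ q = ev-comp p q

  eval-⟨,⟩ᶜ : ∀ {O f g x y z} → Eval O f x y → Eval O g x z → Eval O ⟨ f , g ⟩ᶜ x (pair y z)
  eval-⟨,⟩ᶜ p q = ev-pair p q

  eval-recᶜ-zero : ∀ {O f g a y} → Eval O f a y → Eval O (recᶜ f g) (pair a 0) y
  eval-recᶜ-zero {g = g} p = ev-rec0 {g = g} p

  eval-recᶜ-suc : ∀ {O f g a n y z} → Eval O (recᶜ f g) (pair a n) y →
                  Eval O g (pair (pair a n) y) z → Eval O (recᶜ f g) (pair a (suc n)) z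
  eval-recᶜ-suc {f = f} {g} {a} {n} p q = ev-recS {f = f} {g} {a} {n} p q

∘ᶜ-injective : ∀ {f g f′ g′} → f ∘ᶜ g ≡ f′ ∘ᶜ g′ → f ≡ f′ × g ≡ g′
∘ᶜ-injective {f} {g} {f′} {g′} eq =
  operands-injective 6 f g 6 f′ g′ (trans (sym ∘ᶜ-unfold) (trans eq ∘ᶜ-unfold))

recᶜ-injective : ∀ {f g f′ g′} → recᶜ f g ≡ recᶜ f′ g′ → f ≡ f′ × g ≡ g′
recᶜ-injective {f} {g} {f′} {g′} eq =
  operands-injective 7 f g 7 f′ g′ (trans (sym recᶜ-unfold) (trans eq recᶜ-unfold))

eval-∘ᶜ-inverse : ∀ {O f g x z} → Eval O (f ∘ᶜ g) x z → ∃ λ y → Eval O g x y × Eval O f y z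
eval-∘ᶜ-inverse {f = f} {g} d = invert d ∘ᶜ-unfold
  where
  invert : ∀ {O e x z} → Eval O e x z → e ≡ pair 6 (pair f g) →
           ∃ λ y → Eval O g x y × Eval O f y z
  invert d eq with shape-of 6 (pair f g) d eq
  ... | comp-shape {f = f′} {g′} {p = p} {q} with operands-injective 6 f′ g′ 6 f g eq
  ... | refl , refl = _ , p , q

eval-fstᶜ : ∀ {O} a b → Eval O fstᶜ (pair a b) a
eval-fstᶜ a b = ev-fst {a = a} {b}

eval-sndᶜ : ∀ {O} a b → Eval O sndᶜ (pair a b) b
eval-sndᶜ a b = ev-snd {a = a} {b}

eval-π₁ : ∀ {O x} → Eval O fstᶜ x (π₁ x)
eval-π₁ {x = x} = subst (λ w → Eval _ fstᶜ w (π₁ x)) (pair-unpair x) (eval-fstᶜ (π₁ x) (π₂ x))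

eval-π₂ : ∀ {O x} → Eval O sndᶜ x (π₂ x)
eval-π₂ {x = x} = subst (λ w → Eval _ sndᶜ w (π₂ x)) (pair-unpair x) (eval-sndᶜ (π₁ x) (π₂ x))

eval-recᶜ : ∀ {O f g a} (v : ℕ → ℕ) → Eval O f a (v 0) →
            (∀ n → Eval O g (pair (pair a n) (v n)) (v (suc n))) →
            ∀ n → Eval O (recᶜ f g) (pair a n) (v n)
eval-recᶜ v base step zero    = eval-recᶜ-zero base
eval-recᶜ {a = a} v base step (suc n) =
  eval-recᶜ-suc {a = a} (eval-recᶜ v base step n) (step n)

primrecᶜ : ℕ → ℕ → ℕ
primrecᶜ f g = recᶜ f g ∘ᶜ ⟨ zeroᶜ , idᶜ ⟩ᶜ

eval-primrecᶜ : ∀ {O f g} (v : ℕ → ℕ) → Eval O f 0 (v 0) →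
                (∀ n → Eval O g (pair (pair 0 n) (v n)) (v (suc n))) →
                ∀ n → Eval O (primrecᶜ f g) n (v n)
eval-primrecᶜ v base step n = eval-⟨,⟩ᶜ ev-zero ev-id ⨾ eval-recᶜ v base step n

constᶜ : ℕ → ℕ
constᶜ zero    = zeroᶜ
constᶜ (suc n) = sucᶜ ∘ᶜ constᶜ n

eval-constᶜ : ∀ {O x} n → Eval O (constᶜ n) x n
eval-constᶜ zero    = ev-zero
eval-constᶜ (suc n) = eval-constᶜ n ⨾ ev-succ

mkᶜ : ℕ → ℕ → ℕ → ℕ
mkᶜ k A B = ⟨ constᶜ k , ⟨ A , B ⟩ᶜ ⟩ᶜ

eval-mkᶜ : ∀ {O A B w f g} k → Eval O A w f → Eval O B w g →
           Eval O (mkᶜ k A B) w (pair k (pair f g))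
eval-mkᶜ k p q = eval-⟨,⟩ᶜ (eval-constᶜ k) (eval-⟨,⟩ᶜ p q)

mk∘ᶜ mk⟨,⟩ᶜ mkRecᶜ : ℕ → ℕ → ℕ
mk∘ᶜ   = mkᶜ 6
mk⟨,⟩ᶜ = mkᶜ 5
mkRecᶜ = mkᶜ 7

eval-mk∘ᶜ : ∀ {O A B w f g} → Eval O A w f → Eval O B w g → Eval O (mk∘ᶜ A B) w (f ∘ᶜ g)
eval-mk∘ᶜ p q = subst (Eval _ _ _) (sym ∘ᶜ-unfold) (eval-mkᶜ 6 p q)

eval-mk⟨,⟩ᶜ : ∀ {O A B w f g} → Eval O A w f → Eval O B w g → Eval O (mk⟨,⟩ᶜ A B) w ⟨ f , g ⟩ᶜ
eval-mk⟨,⟩ᶜ p q = subst (Eval _ _ _) (sym ⟨,⟩ᶜ-unfold) (eval-mkᶜ 5 p q)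

eval-mkRecᶜ : ∀ {O A B w f g} → Eval O A w f → Eval O B w g → Eval O (mkRecᶜ A B) w (recᶜ f g)
eval-mkRecᶜ p q = subst (Eval _ _ _) (sym recᶜ-unfold) (eval-mkᶜ 7 p q)

quoteᶜ : ℕ
quoteᶜ = primrecᶜ zeroᶜ (mk∘ᶜ (constᶜ sucᶜ) sndᶜ)

eval-quoteᶜ : ∀ {O x} → Eval O quoteᶜ x (constᶜ x)
eval-quoteᶜ {x = x} = eval-primrecᶜ constᶜ ev-zero
  (λ n → eval-mk∘ᶜ (eval-constᶜ sucᶜ) (eval-sndᶜ (pair 0 n) (constᶜ n))) x

predᶜ : ℕ
predᶜ = primrecᶜ zeroᶜ (sndᶜ ∘ᶜ fstᶜ)

eval-predᶜ : ∀ {O x} → Eval O predᶜ x (pred x)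
eval-predᶜ {x = x} =
  eval-primrecᶜ pred ev-zero (λ n → eval-fstᶜ (pair 0 n) (pred n) ⨾ eval-sndᶜ 0 n) x

infixl 6 _∸ᶜ_
_∸ᶜ_ : ℕ → ℕ → ℕ
A ∸ᶜ B = recᶜ idᶜ (predᶜ ∘ᶜ sndᶜ) ∘ᶜ ⟨ A , B ⟩ᶜ

eval-∸ᶜ : ∀ {O A B w a b} → Eval O A w a → Eval O B w b → Eval O (A ∸ᶜ B) w (a ∸ b)
eval-∸ᶜ {O} {a = a} {b} p q = eval-⟨,⟩ᶜ p q ⨾ eval-recᶜ (a ∸_) ev-id step b
  where
  step : ∀ n → Eval O (predᶜ ∘ᶜ sndᶜ) (pair (pair a n) (a ∸ n)) (a ∸ suc n)
  step n = subst (Eval O _ _) (pred[m∸n]≡m∸[1+n] a n)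
                 (eval-sndᶜ (pair a n) (a ∸ n) ⨾ eval-predᶜ)

infix 0 if0_then_else_ if0ᶜ_then_else_

if0_then_else_ : ℕ → ℕ → ℕ → ℕ
if0 zero  then u else v = u
if0 suc _ then u else v = v

if0ᶜ_then_else_ : ℕ → ℕ → ℕ → ℕ
if0ᶜ B then U else V = recᶜ fstᶜ (sndᶜ ∘ᶜ fstᶜ ∘ᶜ fstᶜ) ∘ᶜ ⟨ ⟨ U , V ⟩ᶜ , B ⟩ᶜ

eval-if0ᶜ : ∀ {O B U V w b u v} → Eval O B w b → Eval O U w u → Eval O V w v →
            Eval O (if0ᶜ B then U else V) w (if0 b then u else v)
eval-if0ᶜ {O} {b = b} {u} {v} pb pu pv =
  eval-⟨,⟩ᶜ (eval-⟨,⟩ᶜ pu pv) pb ⨾ eval-recᶜ (λ b → if0 b then u else v) (eval-fstᶜ u v) step b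
  where
  step : ∀ n → Eval O (sndᶜ ∘ᶜ fstᶜ ∘ᶜ fstᶜ) (pair (pair (pair u v) n) (if0 n then u else v)) v
  step n = eval-fstᶜ _ (if0 n then u else v) ⨾ eval-fstᶜ (pair u v) n ⨾ eval-sndᶜ u v

nth : ℕ → ℕ → ℕ
nth h j = π₁ (iterate π₂ h j)

lookup : ℕ → ℕ → ℕ → ℕ
lookup h n f = nth h (n ∸ f)

nthᶜ : ℕ
nthᶜ = fstᶜ ∘ᶜ recᶜ idᶜ (sndᶜ ∘ᶜ sndᶜ)

eval-nthᶜ : ∀ {O} h j → Eval O nthᶜ (pair h j) (nth h j)
eval-nthᶜ h j = subst (Eval _ _ _) (cong π₁ (iterate-is-fold h π₂ j))
  (eval-recᶜ (fold h π₂) ev-id (λ n → eval-sndᶜ (pair h n) (fold h π₂ n) ⨾ eval-π₂) j ⨾ eval-π₁)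

module CourseOfValues (step : ℕ → ℕ → ℕ) where

  -- history n lists cov n, …, cov 1 as nested pairs; cov 0 is forced to be 0.
  history : ℕ → ℕ
  history zero    = 0
  history (suc n) = pair (step n (history n)) (history n)

  cov : ℕ → ℕ
  cov n = π₁ (history n)

  cov-suc : ∀ n → cov (suc n) ≡ step n (history n)
  cov-suc n = π₁-pair _ _

  history-suffix : ∀ j n → iterate π₂ (history (j + n)) j ≡ history n
  history-suffix zero    n = refl
  history-suffix (suc j) n =
    trans (cong (λ h → iterate π₂ h j) (π₂-pair (step (j + n) (history (j + n))) _))
          (history-suffix j n)

  lookup-history : ∀ {f n} → f ≤ n → lookup (history n) n f ≡ cov f
  lookup-history {f} {n} f≤n = cong π₁ (begin
    iterate π₂ (history n) (n ∸ f)
      ≡⟨ cong (λ m → iterate π₂ (history m) (n ∸ f)) (sym (m∸n+n≡m f≤n)) ⟩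
    iterate π₂ (history (n ∸ f + f)) (n ∸ f)
      ≡⟨ history-suffix (n ∸ f) f ⟩
    history f ∎)
    where open ≡-Reasoning

  covᶜ : ℕ → ℕ
  covᶜ stepᶜ = fstᶜ ∘ᶜ primrecᶜ zeroᶜ ⟨ stepᶜ , sndᶜ ⟩ᶜ

  eval-covᶜ : ∀ {O stepᶜ} → (∀ n h → Eval O stepᶜ (pair (pair 0 n) h) (step n h)) →
              ∀ x → Eval O (covᶜ stepᶜ) x (cov x)
  eval-covᶜ eval-step x =
    eval-primrecᶜ history ev-zero
      (λ n → eval-⟨,⟩ᶜ (eval-step n (history n)) (eval-sndᶜ (pair 0 n) (history n))) x
    ⨾ eval-π₁

  argᶜ : ℕ
  argᶜ = sndᶜ ∘ᶜ fstᶜ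

  eval-argᶜ : ∀ {O n h} → Eval O argᶜ (pair (pair 0 n) h) n
  eval-argᶜ {n = n} {h} = eval-fstᶜ (pair 0 n) h ⨾ eval-sndᶜ 0 n

  lookupᶜ : ℕ → ℕ
  lookupᶜ F = nthᶜ ∘ᶜ ⟨ sndᶜ , argᶜ ∸ᶜ F ⟩ᶜ

  eval-lookupᶜ : ∀ {O F n h f} → Eval O F (pair (pair 0 n) h) f →
                 Eval O (lookupᶜ F) (pair (pair 0 n) h) (lookup h n f)
  eval-lookupᶜ {n = n} {h} {f} p =
    eval-⟨,⟩ᶜ (eval-sndᶜ (pair 0 n) h) (eval-∸ᶜ eval-argᶜ p) ⨾ eval-nthᶜ h (n ∸ f)

diag : ℕ → ℕ
diag y = y ∘ᶜ ⟨ constᶜ y , idᶜ ⟩ᶜ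

diagᶜ : ℕ
diagᶜ = mk∘ᶜ idᶜ (mk⟨,⟩ᶜ quoteᶜ (constᶜ idᶜ))

eval-diagᶜ : ∀ {O y} → Eval O diagᶜ y (diag y)
eval-diagᶜ = eval-mk∘ᶜ ev-id (eval-mk⟨,⟩ᶜ eval-quoteᶜ (eval-constᶜ idᶜ))

fixpointᶜ : ℕ → ℕ
fixpointᶜ h = diag (h ∘ᶜ ⟨ diagᶜ ∘ᶜ fstᶜ , sndᶜ ⟩ᶜ)

eval-fixpointᶜ : ∀ {O h} (G : ℕ → ℕ → ℕ) → (∀ e x → Eval O h (pair e x) (G e x)) →
                 ∀ x → Eval O (fixpointᶜ h) x (G (fixpointᶜ h) x)
eval-fixpointᶜ {h = h} G eval-h x =
  eval-⟨,⟩ᶜ (eval-constᶜ m) ev-id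
  ⨾ (eval-⟨,⟩ᶜ (eval-fstᶜ m x ⨾ eval-diagᶜ) (eval-sndᶜ m x) ⨾ eval-h (diag m) x)
  where
  m : ℕ
  m = h ∘ᶜ ⟨ diagᶜ ∘ᶜ fstᶜ , sndᶜ ⟩ᶜ

module Translation (c : ℕ) where

  -- The value at the code pair k m, given the code itself (self) and the
  -- values at smaller codes (rec).
  translateStep : ℕ → ℕ → ℕ → (ℕ → ℕ) → ℕ
  translateStep k m self rec =
    if0 k ∸ 4 then self else
    if0 k ∸ 7 then pair k (pair (rec (π₁ m)) (rec (π₂ m))) else
    if0 k ∸ 8 then pair 8 (rec m) else
    if0 k ∸ 9 then (if0 m then c else self) else
    self

  open CourseOfValues
    (λ n h → translateStep (π₁ (suc n)) (π₂ (suc n)) (suc n) (lookup h n))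

  translate : ℕ → ℕ
  translate = cov

  translate-unfold : ∀ k m n → pair k m ≡ suc n →
    translate (pair k m) ≡ translateStep k m (pair k m) (lookup (history n) n)
  translate-unfold k m n eq = begin
    translate (pair k m)
      ≡⟨ trans (cong translate eq) (cov-suc n) ⟩
    translateStep (π₁ (suc n)) (π₂ (suc n)) (suc n) recall
      ≡⟨ cong (λ a → translateStep (π₁ a) (π₂ a) a recall) (sym eq) ⟩
    translateStep (π₁ (pair k m)) (π₂ (pair k m)) (pair k m) recall
      ≡⟨ cong₂ (λ k′ m′ → translateStep k′ m′ (pair k m) recall) (π₁-pair k m) (π₂-pair k m) ⟩
    translateStep k m (pair k m) recall ∎
    where
    open ≡-Reasoning
    recall : ℕ → ℕ
    recall = lookup (history n) n

  translate-fixed : ∀ k m → (∀ rec → translateStep k m (pair k m) rec ≡ pair k m) →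
                    translate (pair k m) ≡ pair k m
  translate-fixed k m fixed = at (pair k m) refl
    where
    at : ∀ a → pair k m ≡ a → translate a ≡ a
    at zero    _  = refl
    at (suc n) eq = trans (sym (cong translate eq))
      (trans (translate-unfold k m n eq) (trans (fixed (lookup (history n) n)) eq))

  translate-binary : ∀ k f g →
    (∀ rec → translateStep (suc k) (pair f g) (pair (suc k) (pair f g)) rec
             ≡ pair (suc k) (pair (rec (π₁ (pair f g))) (rec (π₂ (pair f g))))) →
    translate (pair (suc k) (pair f g)) ≡ pair (suc k) (pair (translate f) (translate g))
  translate-binary k f g binary =
    trans (translate-unfold (suc k) (pair f g) n refl)
      (trans (binary recall) (cong₂ (λ u v → pair (suc k) (pair u v))
        (trans (cong recall (π₁-pair f g)) (lookup-history (≤-trans (≤-pairˡ f g) fg≤n)))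
        (trans (cong recall (π₂-pair f g)) (lookup-history (≤-trans (≤-pairʳ f g) fg≤n)))))
    where
    n : ℕ
    n = pred (pair (suc k) (pair f g))
    fg≤n : pair f g ≤ n
    fg≤n = ≤-pred (<-pairʳ k (pair f g))
    recall : ℕ → ℕ
    recall = lookup (history n) n

  translate-pair : ∀ f g →
    translate (pair 5 (pair f g)) ≡ pair 5 (pair (translate f) (translate g))
  translate-pair f g = translate-binary 4 f g (λ _ → refl)

  translate-comp : ∀ f g →
    translate (pair 6 (pair f g)) ≡ pair 6 (pair (translate f) (translate g))
  translate-comp f g = translate-binary 5 f g (λ _ → refl)

  translate-rec : ∀ f g →
    translate (pair 7 (pair f g)) ≡ pair 7 (pair (translate f) (translate g))
  translate-rec f g = translate-binary 6 f g (λ _ → refl)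

  translate-mu : ∀ f → translate (pair 8 f) ≡ pair 8 (translate f)
  translate-mu f = trans (translate-unfold 8 f n refl)
    (cong (pair 8) (lookup-history (≤-pred (<-pairʳ 7 f))))
    where
    n : ℕ
    n = pred (pair 8 f)

  translate-oracle : translate oracleᶜ ≡ c
  translate-oracle = translate-unfold 9 0 _ refl

  -- Equations rather than indices: unifying a with pair 5 (pair f g) would
  -- let Agda unfold translate a on the normalised code.
  data CodeView (a : ℕ) : Set where
    pair-code   : ∀ f g → a ≡ pair 5 (pair f g) → CodeView a
    comp-code   : ∀ f g → a ≡ pair 6 (pair f g) → CodeView a
    rec-code    : ∀ f g → a ≡ pair 7 (pair f g) → CodeView a
    mu-code     : ∀ f → a ≡ pair 8 f → CodeView a
    oracle-code : a ≡ oracleᶜ → CodeView a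
    inert-code  : Inert a → translate a ≡ a → CodeView a

  codeView : ∀ a → CodeView a
  codeView a = subst CodeView (pair-unpair a) (view (π₁ a) (π₂ a))
    where
    inert : ∀ k m → ¬ Active k m → (∀ rec → translateStep k m (pair k m) rec ≡ pair k m) →
            CodeView (pair k m)
    inert k m passive fixed = inert-code
      (λ {k′} {m′} eq → let k≡k′ , m≡m′ = pair-injective k m k′ m′ eq in
                        subst₂ (λ k m → ¬ Active k m) k≡k′ m≡m′ passive)
      (translate-fixed k m fixed)
    binary : ∀ k m → (∀ f g → pair k m ≡ pair k (pair f g) → CodeView (pair k m)) →
             CodeView (pair k m)
    binary k m code = code (π₁ m) (π₂ m) (cong (pair k) (sym (pair-unpair m)))
    view : ∀ k m → CodeView (pair k m)
    view 0 m = inert 0 m (λ ()) (λ _ → refl)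
    view 1 m = inert 1 m (λ ()) (λ _ → refl)
    view 2 m = inert 2 m (λ ()) (λ _ → refl)
    view 3 m = inert 3 m (λ ()) (λ _ → refl)
    view 4 m = inert 4 m (λ ()) (λ _ → refl)
    view 5 m = binary 5 m pair-code
    view 6 m = binary 6 m comp-code
    view 7 m = binary 7 m rec-code
    view 8 m = mu-code m refl
    view 9 zero    = oracle-code refl
    view 9 (suc m) = inert 9 (suc m) (λ ()) (λ _ → refl)
    view k@(suc (suc (suc (suc (suc (suc (suc (suc (suc (suc _)))))))))) m =
      inert k m (λ ()) (λ _ → refl)

  selfᶜ opᶜ operandᶜ : ℕ
  selfᶜ    = sucᶜ ∘ᶜ argᶜ
  opᶜ      = fstᶜ ∘ᶜ selfᶜ
  operandᶜ = sndᶜ ∘ᶜ selfᶜ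

  translateStepᶜ : ℕ
  translateStepᶜ =
    if0ᶜ opᶜ ∸ᶜ constᶜ 4 then selfᶜ else
    if0ᶜ opᶜ ∸ᶜ constᶜ 7
      then ⟨ opᶜ , ⟨ lookupᶜ (fstᶜ ∘ᶜ operandᶜ) , lookupᶜ (sndᶜ ∘ᶜ operandᶜ) ⟩ᶜ ⟩ᶜ else
    if0ᶜ opᶜ ∸ᶜ constᶜ 8 then ⟨ constᶜ 8 , lookupᶜ operandᶜ ⟩ᶜ else
    if0ᶜ opᶜ ∸ᶜ constᶜ 9 then (if0ᶜ operandᶜ then constᶜ c else selfᶜ) else
    selfᶜ

  eval-translateStepᶜ : ∀ {O} n h →
    Eval O translateStepᶜ (pair (pair 0 n) h)
         (translateStep (π₁ (suc n)) (π₂ (suc n)) (suc n) (lookup h n))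
  eval-translateStepᶜ {O} n h =
    eval-if0ᶜ (test 4) self (
    eval-if0ᶜ (test 7)
      (eval-⟨,⟩ᶜ op
        (eval-⟨,⟩ᶜ (eval-lookupᶜ (operand ⨾ eval-π₁)) (eval-lookupᶜ (operand ⨾ eval-π₂)))) (
    eval-if0ᶜ (test 8) (eval-⟨,⟩ᶜ (eval-constᶜ 8) (eval-lookupᶜ operand)) (
    eval-if0ᶜ (test 9) (eval-if0ᶜ operand (eval-constᶜ c) self) self)))
    where
    self : Eval O selfᶜ (pair (pair 0 n) h) (suc n)
    self = eval-argᶜ ⨾ ev-succ
    op : Eval O opᶜ (pair (pair 0 n) h) (π₁ (suc n))
    op = self ⨾ eval-π₁
    operand : Eval O operandᶜ (pair (pair 0 n) h) (π₂ (suc n))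
    operand = self ⨾ eval-π₂
    test : ∀ j → Eval O (opᶜ ∸ᶜ constᶜ j) (pair (pair 0 n) h) (π₁ (suc n) ∸ j)
    test j = eval-∸ᶜ op (eval-constᶜ j)

  translateᶜ : ℕ
  translateᶜ = covᶜ translateStepᶜ

  eval-translateᶜ : ∀ {O x} → Eval O translateᶜ x (translate x)
  eval-translateᶜ {x = x} = eval-covᶜ eval-translateStepᶜ x

  module Simulation {O P : Maybe Subset}
    (oracle⇒c : ∀ {x y} → Eval O oracleᶜ x y → Eval P c x y)
    (c⇒oracle : ∀ {x y} → Eval P c x y → Eval O oracleᶜ x y) where

    translate-sound : ∀ {a x y} → Eval O a x y → Eval P (translate a) x y
    translate-sound ev-zero = recode (sym (translate-fixed 0 0 λ _ → refl)) ev-zero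
    translate-sound ev-succ = recode (sym (translate-fixed 1 0 λ _ → refl)) ev-succ
    translate-sound ev-id   = recode (sym (translate-fixed 2 0 λ _ → refl)) ev-id
    translate-sound (ev-fst {a = a} {b}) =
      recode (sym (translate-fixed 3 0 λ _ → refl)) (ev-fst {a = a} {b})
    translate-sound (ev-snd {a = a} {b}) =
      recode (sym (translate-fixed 4 0 λ _ → refl)) (ev-snd {a = a} {b})
    translate-sound (ev-pair {f = f} {g} p q) =
      recode (sym (translate-pair f g)) (ev-pair (translate-sound p) (translate-sound q))
    translate-sound (ev-comp {f = f} {g} p q) =
      recode (sym (translate-comp f g)) (ev-comp (translate-sound p) (translate-sound q))
    translate-sound (ev-rec0 {f = f} {g} p) =
      recode (sym (translate-rec f g)) (ev-rec0 {g = translate g} (translate-sound p))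
    translate-sound (ev-recS {f = f} {g} {a} {n} p q) =
      recode (sym (translate-rec f g))
        (ev-recS {f = translate f} {translate g} {a} {n}
          (recode (translate-rec f g) (translate-sound p)) (translate-sound q))
    translate-sound (ev-mu {f = f} {x} {n} p h) =
      recode (sym (translate-mu f))
        (ev-mu {f = translate f} {x} {n} (translate-sound p)
          (λ m m<n → proj₁ (h m m<n) , translate-sound (proj₂ (h m m<n))))
    translate-sound ev-orac = recode (sym translate-oracle) (oracle⇒c ev-orac)

    translate-complete : ∀ {e x y} → Eval P e x y → ∀ a → e ≡ translate a → Eval O a x y
    complete-pair : ∀ {e x y f g} → Eval P e x y → e ≡ pair 5 (pair (translate f) (translate g)) →
                    Eval O (pair 5 (pair f g)) x y
    complete-comp : ∀ {e x y f g} → Eval P e x y → e ≡ pair 6 (pair (translate f) (translate g)) →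
                    Eval O (pair 6 (pair f g)) x y
    complete-rec  : ∀ {e x y f g} → Eval P e x y → e ≡ pair 7 (pair (translate f) (translate g)) →
                    Eval O (pair 7 (pair f g)) x y
    complete-mu   : ∀ {e x y f} → Eval P e x y →
                    e ≡ pair 8 (translate f) → Eval O (pair 8 f) x y

    translate-complete d a eq with codeView a
    ... | pair-code f g a≡ = recode (sym a≡)
      (complete-pair {f = f} {g} d (trans eq (trans (cong translate a≡) (translate-pair f g))))
    ... | comp-code f g a≡ = recode (sym a≡)
      (complete-comp {f = f} {g} d (trans eq (trans (cong translate a≡) (translate-comp f g))))
    ... | rec-code f g a≡ = recode (sym a≡)
      (complete-rec {f = f} {g} d (trans eq (trans (cong translate a≡) (translate-rec f g))))
    ... | mu-code f a≡ = recode (sym a≡)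
      (complete-mu {f = f} d (trans eq (trans (cong translate a≡) (translate-mu f))))
    ... | oracle-code a≡ = recode (sym a≡)
      (c⇒oracle (recode (trans eq (trans (cong translate a≡) translate-oracle)) d))
    ... | inert-code inert fixed = inert-eval inert (recode (trans eq fixed) d)

    complete-pair {f = f} {g} d eq with shape-of 5 (pair (translate f) (translate g)) d eq
    ... | pair-shape {f = f′} {g′} {p = p} {q}
      with operands-injective 5 f′ g′ 5 (translate f) (translate g) eq
    ... | refl , refl = ev-pair (translate-complete p f refl) (translate-complete q g refl)

    complete-comp {f = f} {g} d eq with shape-of 6 (pair (translate f) (translate g)) d eq
    ... | comp-shape {f = f′} {g′} {p = p} {q}
      with operands-injective 6 f′ g′ 6 (translate f) (translate g) eq
    ... | refl , refl = ev-comp (translate-complete p g refl) (translate-complete q f refl)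

    complete-rec {f = f} {g} d eq with shape-of 7 (pair (translate f) (translate g)) d eq
    ... | rec0-shape {f = f′} {g′} {a} {p = p}
      with operands-injective 7 f′ g′ 7 (translate f) (translate g) eq
    ... | refl , refl = ev-rec0 {g = g} (translate-complete p f refl)
    complete-rec {f = f} {g} d eq | recS-shape {f = f′} {g′} {a} {n} {p = p} {q}
      with operands-injective 7 f′ g′ 7 (translate f) (translate g) eq
    ... | refl , refl =
      ev-recS {f = f} {g} {a} {n} (complete-rec {f = f} {g} p refl) (translate-complete q g refl)

    complete-mu {f = f} d eq with shape-of 8 (translate f) d eq
    ... | mu-shape {f = f′} {x} {n} {p = p} {h}
      with proj₂ (pair-injective 8 f′ 8 (translate f) eq)
    ... | refl = ev-mu {f = f} {x} {n} (translate-complete p f refl)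
      (λ m m<n → proj₁ (h m m<n) , translate-complete (proj₂ (h m m<n)) f refl)

operand₁ᶜ operand₂ᶜ : ℕ
operand₁ᶜ = fstᶜ ∘ᶜ sndᶜ
operand₂ᶜ = sndᶜ ∘ᶜ sndᶜ

eval-operand₁ᶜ : ∀ {O} k f g → Eval O operand₁ᶜ (pair k (pair f g)) f
eval-operand₁ᶜ k f g = eval-sndᶜ k (pair f g) ⨾ eval-fstᶜ f g

eval-operand₂ᶜ : ∀ {O} k f g → Eval O operand₂ᶜ (pair k (pair f g)) g
eval-operand₂ᶜ k f g = eval-sndᶜ k (pair f g) ⨾ eval-sndᶜ f g

decodeᶜ : ℕ
decodeᶜ = operand₂ᶜ ∘ᶜ operand₁ᶜ ∘ᶜ operand₂ᶜ ∘ᶜ operand₂ᶜ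

-- On pair x 0 the recursion only runs its base case, so a is never run but
-- can be read off the code; this is what makes embed injective.
tagᶜ : ℕ → ℕ
tagᶜ a = recᶜ decodeᶜ a ∘ᶜ ⟨ idᶜ , zeroᶜ ⟩ᶜ

eval-tagᶜ : ∀ {O a x y} → Eval O decodeᶜ x y → Eval O (tagᶜ a) x y
eval-tagᶜ p = eval-⟨,⟩ᶜ ev-id ev-zero ⨾ eval-recᶜ-zero p

eval-decodeᶜ : ∀ {O} e t a → Eval O decodeᶜ (e ∘ᶜ (t ∘ᶜ tagᶜ a)) a
eval-decodeᶜ e t a =
  at ∘ᶜ-unfold (eval-operand₂ᶜ 6 e (t ∘ᶜ tagᶜ a))
  ⨾ at ∘ᶜ-unfold (eval-operand₂ᶜ 6 t (tagᶜ a))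
  ⨾ at ∘ᶜ-unfold (eval-operand₁ᶜ 6 (recᶜ decodeᶜ a) ⟨ idᶜ , zeroᶜ ⟩ᶜ)
  ⨾ at recᶜ-unfold (eval-operand₂ᶜ 7 decodeᶜ a)
  where
  at : ∀ {O c x x′ y} → x′ ≡ x → Eval O c x y → Eval O c x′ y
  at eq d = subst (λ x → Eval _ _ x _) (sym eq) d

module Embedding (c : ℕ) {O P : Maybe Subset}
  (oracle⇒c : ∀ {x y} → Eval O oracleᶜ x y → Eval P c x y)
  (c⇒oracle : ∀ {x y} → Eval P c x y → Eval O oracleᶜ x y) where

  open Translation c
  open Simulation oracle⇒c c⇒oracle

  embedWith : ℕ → ℕ → ℕ
  embedWith e a = e ∘ᶜ (translate a ∘ᶜ tagᶜ a)

  embedWithᶜ : ℕ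
  embedWithᶜ = mk∘ᶜ fstᶜ (mk∘ᶜ (translateᶜ ∘ᶜ sndᶜ)
                              (mk∘ᶜ (mkRecᶜ (constᶜ decodeᶜ) sndᶜ) (constᶜ ⟨ idᶜ , zeroᶜ ⟩ᶜ)))

  eval-embedWithᶜ : ∀ {Q} e a → Eval Q embedWithᶜ (pair e a) (embedWith e a)
  eval-embedWithᶜ e a =
    eval-mk∘ᶜ (eval-fstᶜ e a)
      (eval-mk∘ᶜ (eval-sndᶜ e a ⨾ eval-translateᶜ)
        (eval-mk∘ᶜ (eval-mkRecᶜ (eval-constᶜ decodeᶜ) (eval-sndᶜ e a)) (eval-constᶜ _)))

  embedᶜ : ℕ
  embedᶜ = fixpointᶜ embedWithᶜ

  embed : ℕ → ℕ
  embed = embedWith embedᶜ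

  eval-embedᶜ : ∀ {Q} x → Eval Q embedᶜ x (embed x)
  eval-embedᶜ = eval-fixpointᶜ embedWith eval-embedWithᶜ

  embed-injective : ∀ {a b} → embed a ≡ embed b → a ≡ b
  embed-injective eq =
    proj₂ (recᶜ-injective (proj₁ (∘ᶜ-injective (proj₂ (∘ᶜ-injective (proj₂ (∘ᶜ-injective eq)))))))

  eval-tag-embed : ∀ {Q} a b → Eval Q (tagᶜ a) (embed b) b
  eval-tag-embed a b = eval-tagᶜ (eval-decodeᶜ embedᶜ (translate b) b)

  embed-hom : ∀ a b z → Eval O a b z → Eval P (embed a) (embed b) (embed z)
  embed-hom a b z d = eval-tag-embed a b ⨾ translate-sound d ⨾ eval-embedᶜ z

  embed-reflects : ∀ {a b z} → Eval P (embed a) (embed b) z → ∃ λ y → Eval O a b y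
  embed-reflects {a} {b} d with eval-∘ᶜ-inverse d
  ... | y , d₁ , _ with eval-∘ᶜ-inverse d₁
  ... | u , tagged , translated with eval-deterministic tagged (eval-tag-embed a b) refl refl
  ... | refl = y , translate-complete translated a refl

  computablyEmbeds : ComputablyEmbeds O P
  computablyEmbeds =
    embed , (embedᶜ , eval-embedᶜ) , embed-injective , embed-hom ,
    λ a b undefined (z , d) → undefined (embed-reflects d)

proposition8p2 : (∀ (X Y : Subset) → X ≤T Y → ComputablyEmbeds (just X) (just Y))
                 × (∀ (X : Subset) → ComputablyEmbeds nothing (just X))
proposition8p2 = relative , plain
  where
  relative : ∀ X Y → X ≤T Y → ComputablyEmbeds (just X) (just Y)
  relative X Y (e , e-computes-χ) = Embedding.computablyEmbeds e oracle⇒e e⇒oracle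
    where
    oracle⇒e : ∀ {x y} → Eval (just X) oracleᶜ x y → Eval (just Y) e x y
    oracle⇒e {x} d = subst (Eval _ e x) (eval-deterministic ev-orac d refl refl) (e-computes-χ x)
    e⇒oracle : ∀ {x y} → Eval (just Y) e x y → Eval (just X) oracleᶜ x y
    e⇒oracle {x} d =
      subst (Eval _ oracleᶜ x) (eval-deterministic (e-computes-χ x) d refl refl) ev-orac
  plain : ∀ X → ComputablyEmbeds nothing (just X)
  plain X = Embedding.computablyEmbeds ⊥ᶜ
    (λ d → ⊥-elim (oracleᶜ-undefined-in-plain d)) (λ d → ⊥-elim (⊥ᶜ-undefined d))
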